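{- Let $I$ be an independent set of a graph $G$ and let $k=|I|+1$. Let $G'$ be the graph obtained from $G$ by adding a new vertex $v_G$ and joining it to every vertex of $V(G)\setminus I$. Then $\mathsf{TS}_k(G')$ is obtained from $\mathsf{TS}_k(G)$ by adding the single new node $I\cup\{v_G\}$ together with all its incident edges; that is, $\mathsf{TS}_k(G)$ is an induced subgraph of $\mathsf{TS}_k(G')$ and $V(\mathsf{TS}_k(G'))\setminus V(\mathsf{TS}_k(G))=\{I\cup\{v_G\}\}$.
   Context: All graphs are finite, simple and undirected. An independent set of a graph is a set of pairwise non-adjacent vertices. For a positive integer $k$, $\mathsf{TS}_k(G)$ is the graph whose vertices are the independent sets of $G$ of size exactly $k$, where two such sets $I,J$ are adjacent iff there exist $u,v\in V(G)$ with $I\setminus J=\{u\}$, $J\setminus I=\{v\}$ and $uv\in E(G)$. -}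

module Defs where

open import Data.Nat using (ℕ; suc)
open import Data.Fin using (Fin; zero; suc)
open import Data.Vec using (_∷_)
open import Data.Fin.Subset using (Subset; _∈_; _∉_; _─_; ⁅_⁆; ∣_∣; inside; outside)
open import Data.Empty using (⊥)
open import Data.Product using (∃₂; _×_)
open import Relation.Nullary using (¬_)
open import Relation.Binary.PropositionalEquality using (_≡_)

record Graph (n : ℕ) : Set₁ where
  field
    Adj    : Fin n → Fin n → Set
    sym    : ∀ {u v} → Adj u v → Adj v u
    irrefl : ∀ {u} → ¬ Adj u u
open Graph public

Independent : ∀ {n} → Graph n → Subset n → Set
Independent G S = ∀ u v → u ∈ S → v ∈ S → ¬ Adj G u v

TSVertex : ∀ {n} → Graph n → ℕ → Subset n → Set
TSVertex G k S = Independent G S × ∣ S ∣ ≡ k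

TSAdj : ∀ {n} → Graph n → ℕ → Subset n → Subset n → Set
TSAdj G k I J = TSVertex G k I × TSVertex G k J ×
  ∃₂ λ u v → (I ─ J ≡ ⁅ u ⁆) × (J ─ I ≡ ⁅ v ⁆) × Adj G u v

-- G' : add a new vertex v_G (represented as zero; old vertex i becomes suc i)
-- joined to every vertex of V(G) ∖ I.
extAdj : ∀ {n} → Graph n → Subset n → Fin (suc n) → Fin (suc n) → Set
extAdj G I zero    zero    = ⊥
extAdj G I zero    (suc j) = j ∉ I
extAdj G I (suc i) zero    = i ∉ I
extAdj G I (suc i) (suc j) = Adj G i j

extSym : ∀ {n} (G : Graph n) (I : Subset n) {u v} → extAdj G I u v → extAdj G I v u
extSym G I {zero}  {zero}  ()
extSym G I {zero}  {suc j} p = p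
extSym G I {suc i} {zero}  p = p
extSym G I {suc i} {suc j} p = sym G p

extIrrefl : ∀ {n} (G : Graph n) (I : Subset n) {u} → ¬ extAdj G I u u
extIrrefl G I {zero}  ()
extIrrefl G I {suc i} p = irrefl G p

extend : ∀ {n} → Graph n → Subset n → Graph (suc n)
extend G I = record { Adj = extAdj G I ; sym = λ {u} {v} → extSym G I {u} {v} ; irrefl = λ {u} → extIrrefl G I {u} }

lift : ∀ {n} → Subset n → Subset (suc n)
lift S = outside ∷ S

withNew : ∀ {n} → Subset n → Subset (suc n)
withNew S = inside ∷ S

-- The old vertices span a copy of G inside G', so lifting a subset of V(G)
-- preserves and reflects independence, size and token-sliding adjacency, in
-- every TS_k.  A k-set of G' containing v_G is independent only if its other
-- vertices avoid the neighbourhood V(G) ∖ I of v_G, i.e. lie in I; having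
-- ∣ I ∣ of them, they are exactly I.
module Submission where

open import Defs
open import Data.Nat using (suc; _≤_)
open import Data.Nat.Properties using (suc-injective; 1+n≰n)
open import Data.Fin using (zero; suc)
open import Data.Vec using ([]; _∷_; here; there)
open import Data.Vec.Properties using (∷-injectiveʳ)
open import Data.Fin.Subset using (Subset; _⊆_; ∣_∣; inside; outside)
open import Data.Fin.Subset.Properties using (_∈?_; drop-∷-⊆; p⊆q⇒∣p∣≤∣q∣)
open import Data.Product using (∃; _×_; _,_)
open import Data.Sum using (_⊎_; inj₁; inj₂)
open import Relation.Nullary using (¬_; yes; no; contradiction)
open import Relation.Binary.PropositionalEquality using (_≡_; refl; cong; subst)
open import Function.Bundles using (_⇔_; mk⇔; Equivalence)

p⊆q∧∣p∣≡∣q∣⇒p≡q : ∀ {n} {p q : Subset n} → p ⊆ q → ∣ p ∣ ≡ ∣ q ∣ → p ≡ q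
p⊆q∧∣p∣≡∣q∣⇒p≡q {p = []}          {[]}          _   _  = refl
p⊆q∧∣p∣≡∣q∣⇒p≡q {p = outside ∷ p} {outside ∷ q} p⊆q eq =
  cong (outside ∷_) (p⊆q∧∣p∣≡∣q∣⇒p≡q (drop-∷-⊆ p⊆q) eq)
p⊆q∧∣p∣≡∣q∣⇒p≡q {p = inside  ∷ p} {inside  ∷ q} p⊆q eq =
  cong (inside ∷_) (p⊆q∧∣p∣≡∣q∣⇒p≡q (drop-∷-⊆ p⊆q) (suc-injective eq))
p⊆q∧∣p∣≡∣q∣⇒p≡q {p = inside  ∷ p} {outside ∷ q} p⊆q eq = contradiction (p⊆q here) λ ()
p⊆q∧∣p∣≡∣q∣⇒p≡q {p = outside ∷ p} {inside  ∷ q} p⊆q eq =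
  contradiction (subst (_≤ ∣ q ∣) eq (p⊆q⇒∣p∣≤∣q∣ (drop-∷-⊆ p⊆q))) 1+n≰n

module _ {n} (G : Graph n) (I : Subset n) where

  private
    G′ : Graph (suc n)
    G′ = extend G I

  lift-Independent⇔ : ∀ J → Independent G J ⇔ Independent G′ (lift J)
  lift-Independent⇔ J = mk⇔ to from
    where
    to : Independent G J → Independent G′ (lift J)
    to ind (suc u) (suc v) (there u∈J) (there v∈J) = ind u v u∈J v∈J

    from : Independent G′ (lift J) → Independent G J
    from ind u v u∈J v∈J = ind (suc u) (suc v) (there u∈J) (there v∈J)

  lift-TSVertex⇔ : ∀ k J → TSVertex G k J ⇔ TSVertex G′ k (lift J)
  lift-TSVertex⇔ k J = mk⇔
    (λ (ind , size) → Equivalence.to   (lift-Independent⇔ J) ind , size)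
    (λ (ind , size) → Equivalence.from (lift-Independent⇔ J) ind , size)

  lift-TSAdj⇔ : ∀ k J₁ J₂ → TSAdj G k J₁ J₂ ⇔ TSAdj G′ k (lift J₁) (lift J₂)
  lift-TSAdj⇔ k J₁ J₂ = mk⇔ to from
    where
    to : TSAdj G k J₁ J₂ → TSAdj G′ k (lift J₁) (lift J₂)
    to (vert₁ , vert₂ , u , v , J₁─J₂ , J₂─J₁ , uv) =
      Equivalence.to (lift-TSVertex⇔ k J₁) vert₁ ,
      Equivalence.to (lift-TSVertex⇔ k J₂) vert₂ ,
      suc u , suc v , cong (outside ∷_) J₁─J₂ , cong (outside ∷_) J₂─J₁ , uv

    from : TSAdj G′ k (lift J₁) (lift J₂) → TSAdj G k J₁ J₂
    from (_ , _ , zero  , _     , () , _  , _)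
    from (_ , _ , suc u , zero  , _  , () , _)
    from (vert₁ , vert₂ , suc u , suc v , J₁─J₂ , J₂─J₁ , uv) =
      Equivalence.from (lift-TSVertex⇔ k J₁) vert₁ ,
      Equivalence.from (lift-TSVertex⇔ k J₂) vert₂ ,
      u , v , ∷-injectiveʳ J₁─J₂ , ∷-injectiveʳ J₂─J₁ , uv

  withNew-Independent : Independent G I → Independent G′ (withNew I)
  withNew-Independent ind zero    zero    _          _          ()
  withNew-Independent ind zero    (suc v) _          (there v∈I) v∉I = v∉I v∈I
  withNew-Independent ind (suc u) zero    (there u∈I) _          u∉I = u∉I u∈I
  withNew-Independent ind (suc u) (suc v) (there u∈I) (there v∈I) = ind u v u∈I v∈I

  Independent-withNew⇒⊆ : ∀ K → Independent G′ (inside ∷ K) → K ⊆ I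
  Independent-withNew⇒⊆ K ind {x} x∈K with x ∈? I
  ... | yes x∈I = x∈I
  ... | no  x∉I = contradiction x∉I (ind zero (suc x) here (there x∈K))

  TSVertex-lift⊎withNew : ∀ K → TSVertex G′ (suc ∣ I ∣) K →
    (∃ λ J → TSVertex G (suc ∣ I ∣) J × K ≡ lift J) ⊎ K ≡ withNew I
  TSVertex-lift⊎withNew (outside ∷ J) vert =
    inj₁ (J , Equivalence.from (lift-TSVertex⇔ (suc ∣ I ∣) J) vert , refl)
  TSVertex-lift⊎withNew (inside ∷ K) (ind , size) =
    inj₂ (cong (inside ∷_)
      (p⊆q∧∣p∣≡∣q∣⇒p≡q (Independent-withNew⇒⊆ K ind) (suc-injective size)))

proposition3 : ∀ {n} (G : Graph n) (I : Subset n) → Independent G I →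
    ((∀ J → TSVertex G (suc ∣ I ∣) J ⇔ TSVertex (extend G I) (suc ∣ I ∣) (lift J)) ×
     (∀ J₁ J₂ → TSVertex G (suc ∣ I ∣) J₁ → TSVertex G (suc ∣ I ∣) J₂ →
        TSAdj G (suc ∣ I ∣) J₁ J₂ ⇔ TSAdj (extend G I) (suc ∣ I ∣) (lift J₁) (lift J₂))) ×
    (TSVertex (extend G I) (suc ∣ I ∣) (withNew I) ×
     (∀ J → ¬ (withNew I ≡ lift J)) ×
     (∀ K → TSVertex (extend G I) (suc ∣ I ∣) K →
        (∃ λ J → TSVertex G (suc ∣ I ∣) J × K ≡ lift J) ⊎ K ≡ withNew I))
proposition3 G I indI =
  ( lift-TSVertex⇔ G I (suc ∣ I ∣)
  , λ J₁ J₂ _ _ → lift-TSAdj⇔ G I (suc ∣ I ∣) J₁ J₂ ) ,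
  ( (withNew-Independent G I indI , refl)
  , (λ J ())
  , TSVertex-lift⊎withNew G I )
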